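{- Let $\Pi_q$ be an arbitrary projective plane of order $q\geq 4$ and let $1\leq k\leq (q+1)/2$ be an integer. Then: (i) if $k\geq 3$, then $[0,(k-1)q+1]\cup[(k+1)q,q^2+q+1]\subseteq \mathrm{Sp}(k,\Pi_q)$; (ii) if $k=1$, then $\{2q\}\cup[2q+2,q^2+q+1]\subseteq\mathrm{Sp}(1,\Pi_q)$ and $[1,q+1]\cap\mathrm{Sp}(1,\Pi_q)=\emptyset$; (iii) if $k=2$, then $([0,q+1]\setminus\{2\})\cup[3q,q^2+q+1]\subseteq\mathrm{Sp}(2,\Pi_q)$ and $2\notin\mathrm{Sp}(2,\Pi_q)$. Here intervals denote sets of integers.
   Context: A projective plane of order $q$ has $q^2+q+1$ points and $q^2+q+1$ lines, each line has $q+1$ points, each point lies on $q+1$ lines, two points lie on a unique line and two lines meet in a unique point. A set $S$ of points is $k$-avoiding if no line meets $S$ in exactly $k$ points. $\mathrm{Sp}(k,\Pi_q)$ is the set of integers $m$ for which a $k$-avoiding point set of size $m$ exists in $\Pi_q$. -}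

module Defs where

open import Data.Nat using (ℕ; suc; _+_; _*_; _≤_)
open import Data.Bool using (Bool; true)
open import Data.Fin using (Fin)
open import Data.Fin.Subset using (Subset; _∩_; ∣_∣)
open import Data.Vec using (tabulate)
open import Data.Product using (Σ; _×_)
open import Relation.Binary.PropositionalEquality using (_≡_; _≢_)

planeSize : ℕ → ℕ
planeSize q = q * q + q + 1

-- A projective plane of order q: points and lines are both indexed by
-- Fin (q²+q+1); incidence is a Boolean relation  I p l  ("p lies on l").
record ProjectivePlane (q : ℕ) : Set where
  field
    I : Fin (planeSize q) → Fin (planeSize q) → Bool

  pointsOn : Fin (planeSize q) → Subset (planeSize q)
  pointsOn l = tabulate (λ p → I p l)

  linesThrough : Fin (planeSize q) → Subset (planeSize q)
  linesThrough p = tabulate (λ l → I p l)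

  field
    lineSize  : ∀ l → ∣ pointsOn l ∣ ≡ suc q
    pointDeg  : ∀ p → ∣ linesThrough p ∣ ≡ suc q
    joinLine  : ∀ p p′ → p ≢ p′ →
                Σ (Fin (planeSize q)) λ l → (I p l ≡ true × I p′ l ≡ true) ×
                  (∀ l′ → I p l′ ≡ true → I p′ l′ ≡ true → l′ ≡ l)
    meetPoint : ∀ l l′ → l ≢ l′ →
                Σ (Fin (planeSize q)) λ p → (I p l ≡ true × I p l′ ≡ true) ×
                  (∀ p′ → I p′ l ≡ true → I p′ l′ ≡ true → p′ ≡ p)

module _ {q : ℕ} (Π : ProjectivePlane q) where
  open ProjectivePlane Π

  KAvoiding : ℕ → Subset (planeSize q) → Set
  KAvoiding k S = ∀ l → ∣ S ∩ pointsOn l ∣ ≢ k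

  -- m ∈ Sp(k, Π): there is a k-avoiding point set of size m
  InSp : ℕ → ℕ → Set
  InSp k m = Σ (Subset (planeSize q)) λ S → ∣ S ∣ ≡ m × KAvoiding k S

{-# OPTIONS --safe #-}
module Submission where

-- Small sizes come from a pencil: fix a point P, take r < k lines through P, put a_i ≤ q points
-- other than P on the i-th of them, and possibly P itself (e ∈ {0,1}), with e + a_i ≠ k.  A pencil
-- line then meets the set in e + a_i points, any other line through P in e < k points, and a line
-- missing P meets each pencil line once, hence in at most r < k points.  Every size up to
-- (k − 1)q + 1 has the form e + Σ a_i: use parts q greedily, rewriting a forbidden part k − 1 as
-- (k − 2) + 1, or q + (k − 1) as (q − 1) + k.  Large sizes follow by complementation, which turns
-- k′-avoiding sets into (q + 1 − k′)-avoiding ones.  If P lies in a 1-avoiding set S, each of the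
-- q + 1 lines through P carries a further point of S, and these are distinct, so |S| ≥ q + 2; and
-- the line joining the two points of a 2-set meets it in exactly 2 points.

open import Defs
open import Data.Bool using (Bool; true)
open import Data.Fin using (Fin; zero; suc; fromℕ<)
import Data.Fin.Properties as Fin
open import Data.Fin.Subset
open import Data.Fin.Subset.Properties
open import Data.Nat using (ℕ; zero; suc; _+_; _*_; _∸_; _≤_; _<_; z≤n; s≤s; _≤?_; _≟_)
open import Data.Nat.Properties
open import Data.Nat.Tactic.RingSolver using (solve-∀)
open import Data.Product using (∃; _×_; _,_; proj₁; proj₂)
open import Data.Sum using (_⊎_; inj₁; inj₂; [_,_])
open import Data.Vec using (tabulate; []; _∷_; here; there)
open import Data.Vec.Properties using (lookup∘tabulate; []=⇒lookup; lookup⇒[]=)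
open import Function using (_∘_)
open import Relation.Nullary using (¬_; Dec; yes; no; contradiction)
open import Relation.Binary.PropositionalEquality
  using (_≡_; _≢_; refl; sym; trans; cong; cong₂; subst; subst₂; ≢-sym; module ≡-Reasoning)

private variable
  n : ℕ
  x : Fin n
  p q : Subset n

Disjoint : Subset n → Subset n → Set
Disjoint p q = ∀ {x} → x ∈ p → x ∉ q

Disjoint⇒p∩q≡⊥ : Disjoint p q → p ∩ q ≡ ⊥
Disjoint⇒p∩q≡⊥ {p = p} {q} disj = Empty-unique λ (x , x∈p∩q) →
  let (x∈p , x∈q) = x∈p∩q⁻ p q x∈p∩q in disj x∈p x∈q

Disjoint⇒∣p∪q∣≡∣p∣+∣q∣ : ∀ (p q : Subset n) → Disjoint p q → ∣ p ∪ q ∣ ≡ ∣ p ∣ + ∣ q ∣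
Disjoint⇒∣p∪q∣≡∣p∣+∣q∣ [] [] _ = refl
Disjoint⇒∣p∪q∣≡∣p∣+∣q∣ (inside ∷ p) (inside ∷ q) disj = contradiction here (disj here)
Disjoint⇒∣p∪q∣≡∣p∣+∣q∣ (inside ∷ p) (outside ∷ q) disj =
  cong suc (Disjoint⇒∣p∪q∣≡∣p∣+∣q∣ p q (λ x∈p x∈q → disj (there x∈p) (there x∈q)))
Disjoint⇒∣p∪q∣≡∣p∣+∣q∣ (outside ∷ p) (inside ∷ q) disj = begin
  suc ∣ p ∪ q ∣     ≡⟨ cong suc (Disjoint⇒∣p∪q∣≡∣p∣+∣q∣ p q (λ x∈p x∈q → disj (there x∈p) (there x∈q))) ⟩
  suc (∣ p ∣ + ∣ q ∣) ≡⟨ +-suc ∣ p ∣ ∣ q ∣ ⟨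
  ∣ p ∣ + suc ∣ q ∣ ∎
  where open ≡-Reasoning
Disjoint⇒∣p∪q∣≡∣p∣+∣q∣ (outside ∷ p) (outside ∷ q) disj =
  Disjoint⇒∣p∪q∣≡∣p∣+∣q∣ p q (λ x∈p x∈q → disj (there x∈p) (there x∈q))

∣p∣≡∣q∩p∣+∣∁q∩p∣ : ∀ (q p : Subset n) → ∣ p ∣ ≡ ∣ q ∩ p ∣ + ∣ ∁ q ∩ p ∣
∣p∣≡∣q∩p∣+∣∁q∩p∣ [] [] = refl
∣p∣≡∣q∩p∣+∣∁q∩p∣ (inside ∷ q) (inside ∷ p) = cong suc (∣p∣≡∣q∩p∣+∣∁q∩p∣ q p)
∣p∣≡∣q∩p∣+∣∁q∩p∣ (outside ∷ q) (inside ∷ p) =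
  trans (cong suc (∣p∣≡∣q∩p∣+∣∁q∩p∣ q p)) (sym (+-suc ∣ q ∩ p ∣ ∣ ∁ q ∩ p ∣))
∣p∣≡∣q∩p∣+∣∁q∩p∣ (inside ∷ q) (outside ∷ p) = ∣p∣≡∣q∩p∣+∣∁q∩p∣ q p
∣p∣≡∣q∩p∣+∣∁q∩p∣ (outside ∷ q) (outside ∷ p) = ∣p∣≡∣q∩p∣+∣∁q∩p∣ q p

p⊆q⇒p∩q≡p : p ⊆ q → p ∩ q ≡ p
p⊆q⇒p∩q≡p {p = p} {q} p⊆q = ⊆-antisym (p∩q⊆p p q) (λ x∈p → x∈p∩q⁺ (x∈p , p⊆q x∈p))

x∈p⇒⁅x⁆⊆p : x ∈ p → ⁅ x ⁆ ⊆ p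
x∈p⇒⁅x⁆⊆p {x = x} {p = p} x∈p y∈⁅x⁆ = subst (_∈ p) (sym (x∈⁅y⁆⇒x≡y x y∈⁅x⁆)) x∈p

x∈p⇒1≤∣p∣ : x ∈ p → 1 ≤ ∣ p ∣
x∈p⇒1≤∣p∣ {x = x} x∈p = subst (_≤ _) (∣⁅x⁆∣≡1 x) (p⊆q⇒∣p∣≤∣q∣ (x∈p⇒⁅x⁆⊆p x∈p))

x∈p∧y∈p∧x≢y⇒2≤∣p∣ : ∀ {y} → x ∈ p → y ∈ p → x ≢ y → 2 ≤ ∣ p ∣
x∈p∧y∈p∧x≢y⇒2≤∣p∣ x∈p y∈p x≢y = ≤-<-trans (x∈p⇒1≤∣p∣ (x∈p∧x≢y⇒x∈p-y y∈p (≢-sym x≢y))) (x∈p⇒∣p-x∣<∣p∣ x∈p)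

∣p∣<∣q∣⇒∃x∈q∖p : ∀ (p q : Subset n) → ∣ p ∣ < ∣ q ∣ → ∃ λ x → x ∈ q × x ∉ p
∣p∣<∣q∣⇒∃x∈q∖p (outside ∷ p) (inside ∷ q) _ = zero , here , λ ()
∣p∣<∣q∣⇒∃x∈q∖p (inside ∷ p) (inside ∷ q) (s≤s ∣p∣<∣q∣) =
  let (x , x∈q , x∉p) = ∣p∣<∣q∣⇒∃x∈q∖p p q ∣p∣<∣q∣ in suc x , there x∈q , x∉p ∘ drop-there
∣p∣<∣q∣⇒∃x∈q∖p (s ∷ p) (outside ∷ q) ∣p∣<∣q∣ =
  let (x , x∈q , x∉p) = ∣p∣<∣q∣⇒∃x∈q∖p p q (≤-<-trans (∣p∣≤∣x∷p∣ s p) ∣p∣<∣q∣)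
  in suc x , there x∈q , x∉p ∘ drop-there

1≤∣p∣⇒Nonempty : 1 ≤ ∣ p ∣ → Nonempty p
1≤∣p∣⇒Nonempty {n} {p} 1≤∣p∣ =
  let (x , x∈p , _) = ∣p∣<∣q∣⇒∃x∈q∖p ⊥ p (subst (_< ∣ p ∣) (sym (∣⊥∣≡0 n)) 1≤∣p∣) in x , x∈p

⊆-of-size : ∀ (p : Subset n) a → a ≤ ∣ p ∣ → ∃ λ r → r ⊆ p × ∣ r ∣ ≡ a
⊆-of-size [] zero _ = [] , (λ ()) , refl
⊆-of-size (outside ∷ p) a a≤∣p∣ =
  let (r , r⊆p , ∣r∣≡a) = ⊆-of-size p a a≤∣p∣ in outside ∷ r , out⊆ r⊆p , ∣r∣≡a
⊆-of-size {suc n} (inside ∷ p) zero _ = ⊥ , ⊥⊆ , ∣⊥∣≡0 (suc n)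
⊆-of-size (inside ∷ p) (suc a) (s≤s a≤∣p∣) =
  let (r , r⊆p , ∣r∣≡a) = ⊆-of-size p a a≤∣p∣ in inside ∷ r , in⊆in r⊆p , cong suc ∣r∣≡a

injective⇒∣p∣≤∣q∣ : ∀ {m} (p : Subset m) {q : Subset n} (f : ∀ {x} → x ∈ p → Fin n) →
  (∀ {x} (x∈p : x ∈ p) → f x∈p ∈ q) →
  (∀ {x y} (x∈p : x ∈ p) (y∈p : y ∈ p) → f x∈p ≡ f y∈p → x ≡ y) →
  ∣ p ∣ ≤ ∣ q ∣
injective⇒∣p∣≤∣q∣ [] _ _ _ = z≤n
injective⇒∣p∣≤∣q∣ (outside ∷ p) f f∈q f-inj =
  injective⇒∣p∣≤∣q∣ p (f ∘ there) (f∈q ∘ there)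
    (λ x∈p y∈p → Fin.suc-injective ∘ f-inj (there x∈p) (there y∈p))
injective⇒∣p∣≤∣q∣ (inside ∷ p) {q} f f∈q f-inj = ≤-<-trans ∣p∣≤∣q-f₀∣ (x∈p⇒∣p-x∣<∣p∣ (f∈q here))
  where
  ∣p∣≤∣q-f₀∣ : ∣ p ∣ ≤ ∣ q - f here ∣
  ∣p∣≤∣q-f₀∣ = injective⇒∣p∣≤∣q∣ p (f ∘ there)
    (λ x∈p → x∈p∧x≢y⇒x∈p-y (f∈q (there x∈p)) (Fin.0≢1+n ∘ sym ∘ f-inj (there x∈p) here))
    (λ x∈p y∈p → Fin.suc-injective ∘ f-inj (there x∈p) (there y∈p))

data Partition (q F : ℕ) : ℕ → ℕ → Set where
  [] : ∀ {r} → Partition q F r 0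
  cons : ∀ {r m} a → a ≤ q → a ≢ F → Partition q F r m → Partition q F (suc r) (a + m)

weaken : ∀ {q F r m} → Partition q F r m → Partition q F (suc r) m
weaken [] = []
weaken (cons a a≤q a≢F parts) = cons a a≤q a≢F (weaken parts)

singleton : ∀ {q F r a} → a ≤ q → a ≢ F → Partition q F (suc r) a
singleton {q} {F} {a = a} a≤q a≢F = subst (Partition q F _) (+-identityʳ a) (cons a a≤q a≢F [])

F-as-two-parts : ∀ {q F} → 2 ≤ F → F < q → Partition q F 2 F
F-as-two-parts {q} (s≤s (s≤s {n = F′} _)) F<q = subst (Partition q _ 2) (+-comm (suc F′) 1)
  (cons (suc F′) (≤-trans (n≤1+n (suc F′)) (<⇒≤ F<q)) (<⇒≢ (n<1+n (suc F′)))
    (singleton (≤-trans (s≤s z≤n) F<q) (λ ())))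

q+F-as-two-parts : ∀ {q F} → suc F < q → Partition q F 2 (q + F)
q+F-as-two-parts {suc q′} {F} (s≤s F<q′) = subst (Partition _ F 2) (+-suc q′ F)
  (cons q′ (n≤1+n q′) (≢-sym (<⇒≢ F<q′)) (singleton (m≤n⇒m≤1+n F<q′) (≢-sym (<⇒≢ (n<1+n F)))))

module _ {q F : ℕ} (2≤F : 2 ≤ F) (F<q : F < q) where

  private
    0<q : 0 < q
    0<q = ≤-trans (s≤s z≤n) F<q

    q≢F : q ≢ F
    q≢F = ≢-sym (<⇒≢ F<q)

  -- For F = q − 1 the number (2 + r) * q − 1 is not such a sum: its parts would be q's and one q − 1.
  partition : ∀ r m → m ≤ (2 + r) * q → (suc F ≡ q → suc m ≢ (2 + r) * q) →
              Partition q F (2 + r) m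
  partition r m m≤ exc with q ≤? m
  partition zero m _ _ | no q≰m with m ≟ F
  ... | no m≢F = singleton (<⇒≤ (≰⇒> q≰m)) m≢F
  ... | yes refl = F-as-two-parts 2≤F F<q
  partition (suc r) m _ _ | no q≰m = weaken (partition r m m≤[2+r]q (λ _ → <⇒≢ 1+m<[2+r]q))
    where
    m<q : m < q
    m<q = ≰⇒> q≰m
    m≤[2+r]q : m ≤ (2 + r) * q
    m≤[2+r]q = ≤-trans (<⇒≤ m<q) (m≤m+n q _)
    1+m<[2+r]q : suc m < (2 + r) * q
    1+m<[2+r]q = ≤-<-trans m<q (m<m+n q (≤-trans 0<q (m≤m+n q (r * q))))
  partition r m m≤ exc | yes q≤m with m≤n⇒∃[o]m+o≡n q≤m
  partition zero _ m≤ exc | yes _ | m′ , refl with m′ ≟ F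
  ... | no m′≢F = cons q ≤-refl q≢F (singleton m′≤q m′≢F)
    where
    m′≤q : m′ ≤ q
    m′≤q = subst (m′ ≤_) (+-identityʳ q) (+-cancelˡ-≤ q _ _ m≤)
  ... | yes refl = q+F-as-two-parts (≤∧≢⇒< F<q λ 1+F≡q → exc 1+F≡q (begin
    suc (q + F) ≡⟨ +-suc q F ⟨
    q + suc F   ≡⟨ cong (q +_) (trans 1+F≡q (sym (+-identityʳ q))) ⟩
    q + (q + 0) ∎))
    where open ≡-Reasoning
  partition (suc r) _ m≤ exc | yes _ | m′ , refl =
    cons q ≤-refl q≢F (partition r m′ (+-cancelˡ-≤ q _ _ m≤)
      (λ 1+F≡q 1+m′≡ → exc 1+F≡q (trans (sym (+-suc q m′)) (cong (q +_) 1+m′≡))))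

planeSize-split : ∀ {q} k K′ → k + K′ ≡ q → planeSize q ≡ (k + 1) * q + (K′ * q + 1)
planeSize-split k K′ refl = identity k K′
  where
  identity : ∀ k K′ → (k + K′) * (k + K′) + (k + K′) + 1 ≡ (k + 1) * (k + K′) + (K′ * (k + K′) + 1)
  identity = solve-∀

m+n≡o∧m≤p⇒o∸p≤n : ∀ {m n o p} → m + n ≡ o → m ≤ p → o ∸ p ≤ n
m+n≡o∧m≤p⇒o∸p≤n {m} {n} refl m≤p = ≤-trans (∸-monoʳ-≤ (m + n) m≤p) (≤-reflexive (m+n∸m≡n m n))

m+[n+1]∸n≡m+1 : ∀ m n → m + (n + 1) ∸ n ≡ m + 1
m+[n+1]∸n≡m+1 m n = trans (cong (_∸ n) (regroup m n)) (m+n∸n≡m (m + 1) n)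
  where
  regroup : ∀ m n → m + (n + 1) ≡ m + 1 + n
  regroup = solve-∀

k+2≤q : ∀ {k q} → 3 ≤ k → 2 * k ≤ q + 1 → k + 2 ≤ q
k+2≤q {k} {q} 3≤k 2k≤q+1 = +-cancelʳ-≤ 1 (k + 2) q (begin
  k + 2 + 1   ≡⟨ +-assoc k 2 1 ⟩
  k + 3       ≤⟨ +-monoʳ-≤ k 3≤k ⟩
  k + k       ≡⟨ cong (k +_) (+-identityʳ k) ⟨
  2 * k       ≤⟨ 2k≤q+1 ⟩
  q + 1       ∎)
  where open ≤-Reasoning

∈-tabulate⁻ : ∀ {f : Fin n → Bool} → x ∈ tabulate f → f x ≡ true
∈-tabulate⁻ {x = x} {f = f} x∈ = trans (sym (lookup∘tabulate f x)) ([]=⇒lookup x∈)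

∈-tabulate⁺ : ∀ {f : Fin n → Bool} → f x ≡ true → x ∈ tabulate f
∈-tabulate⁺ {x = x} {f = f} fx≡true = lookup⇒[]= x (tabulate f) (trans (lookup∘tabulate f x) fx≡true)

module _ {q : ℕ} (Π : ProjectivePlane q) where
  open ProjectivePlane Π

  private
    Point = Fin (planeSize q)

  ∈pointsOn⇒∈linesThrough : ∀ {x l : Point} → x ∈ pointsOn l → l ∈ linesThrough x
  ∈pointsOn⇒∈linesThrough = ∈-tabulate⁺ ∘ ∈-tabulate⁻

  ∈linesThrough⇒∈pointsOn : ∀ {x l : Point} → l ∈ linesThrough x → x ∈ pointsOn l
  ∈linesThrough⇒∈pointsOn = ∈-tabulate⁺ ∘ ∈-tabulate⁻

  join-unique : ∀ {x y l m : Point} → x ≢ y → x ∈ pointsOn l → y ∈ pointsOn l →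
                x ∈ pointsOn m → y ∈ pointsOn m → l ≡ m
  join-unique {x} {y} {l} {m} x≢y x∈l y∈l x∈m y∈m =
    let (_ , _ , unique) = joinLine x y x≢y
    in trans (unique l (∈-tabulate⁻ x∈l) (∈-tabulate⁻ y∈l))
             (sym (unique m (∈-tabulate⁻ x∈m) (∈-tabulate⁻ y∈m)))

  q≤∣l∖x∣ : ∀ x l → q ≤ ∣ ∁ ⁅ x ⁆ ∩ pointsOn l ∣
  q≤∣l∖x∣ x l = ≤-pred (begin
    suc q                                               ≡⟨ lineSize l ⟨
    ∣ pointsOn l ∣                                      ≡⟨ ∣p∣≡∣q∩p∣+∣∁q∩p∣ ⁅ x ⁆ (pointsOn l) ⟩
    ∣ ⁅ x ⁆ ∩ pointsOn l ∣ + ∣ ∁ ⁅ x ⁆ ∩ pointsOn l ∣ ≤⟨ +-monoˡ-≤ _ (∣p∩q∣≤∣p∣ ⁅ x ⁆ (pointsOn l)) ⟩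
    ∣ ⁅ x ⁆ ∣ + ∣ ∁ ⁅ x ⁆ ∩ pointsOn l ∣               ≡⟨ cong (_+ ∣ ∁ ⁅ x ⁆ ∩ pointsOn l ∣) (∣⁅x⁆∣≡1 x) ⟩
    suc ∣ ∁ ⁅ x ⁆ ∩ pointsOn l ∣                        ∎)
    where open ≤-Reasoning

  module Pencil (P : Point) where

    record PencilSet (F r m : ℕ) : Set where
      field
        T U            : Subset (planeSize q)
        P∉T            : P ∉ T
        U⊆linesThrough : U ⊆ linesThrough P
        ∣U∣≤r          : ∣ U ∣ ≤ r
        ∣T∣≡m          : ∣ T ∣ ≡ m
        covered        : ∀ {x} → x ∈ T → ∃ λ l → l ∈ U × x ∈ pointsOn l
        ∣T∩l∣≢F        : ∀ {l} → l ∈ U → ∣ T ∩ pointsOn l ∣ ≢ F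

      x∈T⇒x≢P : ∀ {x} → x ∈ T → x ≢ P
      x∈T⇒x≢P x∈T refl = P∉T x∈T

      Disjoint-T-off-U : ∀ {l} → P ∈ pointsOn l → l ∉ U → Disjoint T (pointsOn l)
      Disjoint-T-off-U P∈l l∉U x∈T x∈l =
        let (m , m∈U , x∈m) = covered x∈T
            l≡m = join-unique (x∈T⇒x≢P x∈T) x∈l P∈l x∈m (∈linesThrough⇒∈pointsOn (U⊆linesThrough m∈U))
        in l∉U (subst (_∈ U) (sym l≡m) m∈U)

      ∣T∩l∣≤r-off-P : ∀ {l} → P ∉ pointsOn l → ∣ T ∩ pointsOn l ∣ ≤ r
      ∣T∩l∣≤r-off-P {l} P∉l =
        ≤-trans (injective⇒∣p∣≤∣q∣ (T ∩ pointsOn l) line line∈U line-injective) ∣U∣≤r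
        where
        on-T : ∀ {x} → x ∈ T ∩ pointsOn l → x ∈ T
        on-T = proj₁ ∘ x∈p∩q⁻ T (pointsOn l)
        on-l : ∀ {x} → x ∈ T ∩ pointsOn l → x ∈ pointsOn l
        on-l = proj₂ ∘ x∈p∩q⁻ T (pointsOn l)
        line : ∀ {x} → x ∈ T ∩ pointsOn l → Point
        line = proj₁ ∘ covered ∘ on-T
        line∈U : ∀ {x} (x∈ : x ∈ T ∩ pointsOn l) → line x∈ ∈ U
        line∈U = proj₁ ∘ proj₂ ∘ covered ∘ on-T
        on-line : ∀ {x} (x∈ : x ∈ T ∩ pointsOn l) → x ∈ pointsOn (line x∈)
        on-line = proj₂ ∘ proj₂ ∘ covered ∘ on-T
        line-injective : ∀ {x y} (x∈ : x ∈ T ∩ pointsOn l) (y∈ : y ∈ T ∩ pointsOn l) →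
                         line x∈ ≡ line y∈ → x ≡ y
        line-injective {x} {y} x∈ y∈ same with x Fin.≟ y
        ... | yes x≡y = x≡y
        ... | no x≢y = contradiction (subst (λ m → P ∈ pointsOn m) (sym l≡m) P∈m) P∉l
          where
          l≡m = join-unique x≢y (on-l x∈) (on-l y∈) (on-line x∈)
                  (subst (λ m → y ∈ pointsOn m) (sym same) (on-line y∈))
          P∈m = ∈linesThrough⇒∈pointsOn (U⊆linesThrough (line∈U x∈))

    open PencilSet

    addLine : ∀ {F r m a} (ps : PencilSet F r m) {ℓ} → P ∈ pointsOn ℓ → ℓ ∉ U ps →
              (A : Subset (planeSize q)) → A ⊆ ∁ ⁅ P ⁆ ∩ pointsOn ℓ → ∣ A ∣ ≡ a → a ≢ F →
              PencilSet F (suc r) (a + m)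
    addLine {F} {r} {m} {a} ps {ℓ} P∈ℓ ℓ∉U A A⊆ℓ∖P ∣A∣≡a a≢F = record
      { T = A ∪ T ps ; U = ⁅ ℓ ⁆ ∪ U ps ; P∉T = P∉T′ ; U⊆linesThrough = U′⊆linesThrough
      ; ∣U∣≤r = ∣U′∣≤1+r ; ∣T∣≡m = ∣T′∣≡a+m ; covered = covered′ ; ∣T∩l∣≢F = ∣T′∩l∣≢F }
      where
      open ≡-Reasoning

      x∈A⇒x∈ℓ : ∀ {x} → x ∈ A → x ∈ pointsOn ℓ
      x∈A⇒x∈ℓ = proj₂ ∘ x∈p∩q⁻ (∁ ⁅ P ⁆) (pointsOn ℓ) ∘ A⊆ℓ∖P

      x∈A⇒x≢P : ∀ {x} → x ∈ A → x ≢ P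
      x∈A⇒x≢P = x∉⁅y⁆⇒x≢y ∘ x∈∁p⇒x∉p ∘ proj₁ ∘ x∈p∩q⁻ (∁ ⁅ P ⁆) (pointsOn ℓ) ∘ A⊆ℓ∖P

      Disjoint-A-T : Disjoint A (T ps)
      Disjoint-A-T x∈A x∈T = Disjoint-T-off-U ps P∈ℓ ℓ∉U x∈T (x∈A⇒x∈ℓ x∈A)

      Disjoint-A-on-U : ∀ {l} → l ∈ U ps → Disjoint A (pointsOn l)
      Disjoint-A-on-U l∈U x∈A x∈l = ℓ∉U (subst (_∈ U ps) (sym ℓ≡l) l∈U)
        where
        P∈l = ∈linesThrough⇒∈pointsOn (U⊆linesThrough ps l∈U)
        ℓ≡l = join-unique (x∈A⇒x≢P x∈A) (x∈A⇒x∈ℓ x∈A) P∈ℓ x∈l P∈l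

      P∉T′ : P ∉ A ∪ T ps
      P∉T′ = [ (λ P∈A → x∈A⇒x≢P P∈A refl) , P∉T ps ] ∘ x∈p∪q⁻ A (T ps)

      U′⊆linesThrough : ⁅ ℓ ⁆ ∪ U ps ⊆ linesThrough P
      U′⊆linesThrough = [ (λ l∈⁅ℓ⁆ → subst (_∈ linesThrough P) (sym (x∈⁅y⁆⇒x≡y ℓ l∈⁅ℓ⁆)) ℓ∈linesThrough)
                        , U⊆linesThrough ps ] ∘ x∈p∪q⁻ ⁅ ℓ ⁆ (U ps)
        where ℓ∈linesThrough = ∈pointsOn⇒∈linesThrough P∈ℓ

      ∣U′∣≤1+r : ∣ ⁅ ℓ ⁆ ∪ U ps ∣ ≤ suc r
      ∣U′∣≤1+r = ≤-trans (≤-reflexive (begin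
        ∣ ⁅ ℓ ⁆ ∪ U ps ∣       ≡⟨ Disjoint⇒∣p∪q∣≡∣p∣+∣q∣ ⁅ ℓ ⁆ (U ps) Disjoint-ℓ-U ⟩
        ∣ ⁅ ℓ ⁆ ∣ + ∣ U ps ∣   ≡⟨ cong (_+ ∣ U ps ∣) (∣⁅x⁆∣≡1 ℓ) ⟩
        suc ∣ U ps ∣           ∎)) (s≤s (∣U∣≤r ps))
        where
        Disjoint-ℓ-U : Disjoint ⁅ ℓ ⁆ (U ps)
        Disjoint-ℓ-U l∈⁅ℓ⁆ = subst (_∉ U ps) (sym (x∈⁅y⁆⇒x≡y ℓ l∈⁅ℓ⁆)) ℓ∉U

      ∣T′∣≡a+m : ∣ A ∪ T ps ∣ ≡ a + m
      ∣T′∣≡a+m = trans (Disjoint⇒∣p∪q∣≡∣p∣+∣q∣ A (T ps) Disjoint-A-T) (cong₂ _+_ ∣A∣≡a (∣T∣≡m ps))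

      covered′ : ∀ {x} → x ∈ A ∪ T ps → ∃ λ l → l ∈ ⁅ ℓ ⁆ ∪ U ps × x ∈ pointsOn l
      covered′ = [ (λ x∈A → ℓ , x∈p∪q⁺ (inj₁ (x∈⁅x⁆ ℓ)) , x∈A⇒x∈ℓ x∈A)
                 , (λ x∈T → let (l , l∈U , x∈l) = covered ps x∈T in l , x∈p∪q⁺ (inj₂ l∈U) , x∈l)
                 ] ∘ x∈p∪q⁻ A (T ps)

      T′∩ℓ≡A : (A ∪ T ps) ∩ pointsOn ℓ ≡ A
      T′∩ℓ≡A = begin
        (A ∪ T ps) ∩ pointsOn ℓ              ≡⟨ ∩-distribʳ-∪ (pointsOn ℓ) A (T ps) ⟩
        A ∩ pointsOn ℓ ∪ T ps ∩ pointsOn ℓ   ≡⟨ cong₂ _∪_ (p⊆q⇒p∩q≡p x∈A⇒x∈ℓ)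
                                                        (Disjoint⇒p∩q≡⊥ (Disjoint-T-off-U ps P∈ℓ ℓ∉U)) ⟩
        A ∪ ⊥                                ≡⟨ ∪-identityʳ A ⟩
        A                                    ∎

      T′∩l≡T∩l : ∀ {l} → l ∈ U ps → (A ∪ T ps) ∩ pointsOn l ≡ T ps ∩ pointsOn l
      T′∩l≡T∩l {l} l∈U = begin
        (A ∪ T ps) ∩ pointsOn l              ≡⟨ ∩-distribʳ-∪ (pointsOn l) A (T ps) ⟩
        A ∩ pointsOn l ∪ T ps ∩ pointsOn l   ≡⟨ cong (_∪ T ps ∩ pointsOn l)
                                                     (Disjoint⇒p∩q≡⊥ (Disjoint-A-on-U l∈U)) ⟩
        ⊥ ∪ T ps ∩ pointsOn l                ≡⟨ ∪-identityˡ _ ⟩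
        T ps ∩ pointsOn l                    ∎

      ∣T′∩l∣≢F : ∀ {l} → l ∈ ⁅ ℓ ⁆ ∪ U ps → ∣ (A ∪ T ps) ∩ pointsOn l ∣ ≢ F
      ∣T′∩l∣≢F {l} = [ (λ l∈⁅ℓ⁆ → subst (λ l → ∣ (A ∪ T ps) ∩ pointsOn l ∣ ≢ F) (sym (x∈⁅y⁆⇒x≡y ℓ l∈⁅ℓ⁆))
                                       (subst (_≢ F) (trans (sym ∣A∣≡a) (cong ∣_∣ (sym T′∩ℓ≡A))) a≢F))
                     , (λ l∈U → subst (_≢ F) (cong ∣_∣ (sym (T′∩l≡T∩l l∈U))) (∣T∩l∣≢F ps l∈U))
                     ] ∘ x∈p∪q⁻ ⁅ ℓ ⁆ (U ps)

    pencilSet : ∀ {F r m} → Partition q F r m → r ≤ suc q → PencilSet F r m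
    pencilSet [] _ = record
      { T = ⊥ ; U = ⊥ ; P∉T = ∉⊥ ; U⊆linesThrough = ⊥⊆
      ; ∣U∣≤r = subst (_≤ _) (sym (∣⊥∣≡0 (planeSize q))) z≤n ; ∣T∣≡m = ∣⊥∣≡0 (planeSize q)
      ; covered = λ x∈⊥ → contradiction x∈⊥ ∉⊥ ; ∣T∩l∣≢F = λ l∈⊥ → contradiction l∈⊥ ∉⊥ }
    pencilSet (cons a a≤q a≢F parts) (s≤s r≤q) =
      let ps = pencilSet parts (m≤n⇒m≤1+n r≤q)
          ∣U∣<∣linesThrough∣ =
            ≤-<-trans (≤-trans (∣U∣≤r ps) r≤q) (subst (q <_) (sym (pointDeg P)) (n<1+n q))
          (ℓ , ℓ∈linesThrough , ℓ∉U) = ∣p∣<∣q∣⇒∃x∈q∖p (U ps) (linesThrough P) ∣U∣<∣linesThrough∣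
          (A , A⊆ℓ∖P , ∣A∣≡a) = ⊆-of-size (∁ ⁅ P ⁆ ∩ pointsOn ℓ) a (≤-trans a≤q (q≤∣l∖x∣ P ℓ))
      in addLine ps (∈linesThrough⇒∈pointsOn ℓ∈linesThrough) ℓ∉U A A⊆ℓ∖P ∣A∣≡a a≢F

    Disjoint-E-T : ∀ {F r m E} (ps : PencilSet F r m) → E ⊆ ⁅ P ⁆ → Disjoint E (T ps)
    Disjoint-E-T ps E⊆⁅P⁆ x∈E = P∉T ps ∘ subst (_∈ T ps) (x∈⁅y⁆⇒x≡y P (E⊆⁅P⁆ x∈E))

    pencil-avoiding : ∀ {k F r m} (ps : PencilSet F r m) (E : Subset (planeSize q)) → E ⊆ ⁅ P ⁆ →
                      ∣ E ∣ + F ≡ k → ∣ E ∣ < k → r < k → KAvoiding Π k (E ∪ T ps)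
    pencil-avoiding {k} {F} {r} ps E E⊆⁅P⁆ e+F≡k e<k r<k l =
      subst (_≢ k) (sym ∣S∩l∣≡) (count≢k (P ∈? pointsOn l) (l ∈? U ps))
      where
      open ≡-Reasoning

      ∣S∩l∣≡ : ∣ (E ∪ T ps) ∩ pointsOn l ∣ ≡ ∣ E ∩ pointsOn l ∣ + ∣ T ps ∩ pointsOn l ∣
      ∣S∩l∣≡ = trans (cong ∣_∣ (∩-distribʳ-∪ (pointsOn l) E (T ps)))
        (Disjoint⇒∣p∪q∣≡∣p∣+∣q∣ _ _ λ x∈E∩l x∈T∩l →
          Disjoint-E-T ps E⊆⁅P⁆ (proj₁ (x∈p∩q⁻ E _ x∈E∩l)) (proj₁ (x∈p∩q⁻ (T ps) _ x∈T∩l)))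

      ∣E∩l∣≡∣E∣ : P ∈ pointsOn l → ∣ E ∩ pointsOn l ∣ ≡ ∣ E ∣
      ∣E∩l∣≡∣E∣ P∈l = cong ∣_∣ (p⊆q⇒p∩q≡p (⊆-trans E⊆⁅P⁆ (x∈p⇒⁅x⁆⊆p P∈l)))

      ∣E∩l∣≡0 : P ∉ pointsOn l → ∣ E ∩ pointsOn l ∣ ≡ 0
      ∣E∩l∣≡0 P∉l = trans (cong ∣_∣ (Disjoint⇒p∩q≡⊥ λ x∈E x∈l →
        P∉l (subst (_∈ pointsOn l) (x∈⁅y⁆⇒x≡y P (E⊆⁅P⁆ x∈E)) x∈l))) (∣⊥∣≡0 (planeSize q))

      ∣T∩l∣≡0 : P ∈ pointsOn l → l ∉ U ps → ∣ T ps ∩ pointsOn l ∣ ≡ 0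
      ∣T∩l∣≡0 P∈l l∉U =
        trans (cong ∣_∣ (Disjoint⇒p∩q≡⊥ (Disjoint-T-off-U ps P∈l l∉U))) (∣⊥∣≡0 (planeSize q))

      count≢k : Dec (P ∈ pointsOn l) → Dec (l ∈ U ps) → ∣ E ∩ pointsOn l ∣ + ∣ T ps ∩ pointsOn l ∣ ≢ k
      count≢k (yes P∈l) (yes l∈U) eq = ∣T∩l∣≢F ps l∈U (+-cancelˡ-≡ ∣ E ∣ _ _ (begin
        ∣ E ∣ + ∣ T ps ∩ pointsOn l ∣              ≡⟨ cong (_+ ∣ T ps ∩ pointsOn l ∣) (∣E∩l∣≡∣E∣ P∈l) ⟨
        ∣ E ∩ pointsOn l ∣ + ∣ T ps ∩ pointsOn l ∣ ≡⟨ eq ⟩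
        k                                          ≡⟨ e+F≡k ⟨
        ∣ E ∣ + F                                  ∎))
      count≢k (yes P∈l) (no l∉U) eq = <⇒≢ e<k (begin
        ∣ E ∣                                      ≡⟨ +-identityʳ ∣ E ∣ ⟨
        ∣ E ∣ + 0                                  ≡⟨ cong₂ _+_ (∣E∩l∣≡∣E∣ P∈l) (∣T∩l∣≡0 P∈l l∉U) ⟨
        ∣ E ∩ pointsOn l ∣ + ∣ T ps ∩ pointsOn l ∣ ≡⟨ eq ⟩
        k                                          ∎)
      count≢k (no P∉l) _ eq = <⇒≢ (≤-<-trans (∣T∩l∣≤r-off-P ps P∉l) r<k) (begin
        ∣ T ps ∩ pointsOn l ∣                      ≡⟨ cong (_+ ∣ T ps ∩ pointsOn l ∣) (∣E∩l∣≡0 P∉l) ⟨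
        ∣ E ∩ pointsOn l ∣ + ∣ T ps ∩ pointsOn l ∣ ≡⟨ eq ⟩
        k                                          ∎)

    Partition⇒InSp : ∀ {k e F r m} → e ≤ 1 → e + F ≡ k → e < k → r < k → r ≤ suc q →
                  Partition q F r m → InSp Π k (e + m)
    Partition⇒InSp {k} {e} {F} e≤1 e+F≡k e<k r<k r≤1+q parts =
      let ps = pencilSet parts r≤1+q
          (E , E⊆⁅P⁆ , ∣E∣≡e) = ⊆-of-size ⁅ P ⁆ e (subst (e ≤_) (sym (∣⁅x⁆∣≡1 P)) e≤1)
      in E ∪ T ps
       , trans (Disjoint⇒∣p∪q∣≡∣p∣+∣q∣ E (T ps) (Disjoint-E-T ps E⊆⁅P⁆)) (cong₂ _+_ ∣E∣≡e (∣T∣≡m ps))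
       , pencil-avoiding ps E E⊆⁅P⁆ (subst (λ e → e + F ≡ k) (sym ∣E∣≡e) e+F≡k)
                                    (subst (_< k) (sym ∣E∣≡e) e<k) r<k

  origin : Point
  origin = fromℕ< (m≤n+m 1 (q * q + q))

  ∁-avoiding : ∀ {k k′ S} → k + k′ ≡ suc q → KAvoiding Π k′ S → KAvoiding Π k (∁ S)
  ∁-avoiding {k} {k′} {S} k+k′≡1+q S-avoids l ∣∁S∩l∣≡k = S-avoids l (+-cancelʳ-≡ k _ _ (begin
    ∣ S ∩ pointsOn l ∣ + k                      ≡⟨ cong (∣ S ∩ pointsOn l ∣ +_) ∣∁S∩l∣≡k ⟨
    ∣ S ∩ pointsOn l ∣ + ∣ ∁ S ∩ pointsOn l ∣   ≡⟨ ∣p∣≡∣q∩p∣+∣∁q∩p∣ S (pointsOn l) ⟨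
    ∣ pointsOn l ∣                              ≡⟨ lineSize l ⟩
    suc q                                       ≡⟨ k+k′≡1+q ⟨
    k + k′                                      ≡⟨ +-comm k k′ ⟩
    k′ + k                                      ∎))
    where open ≡-Reasoning

  InSp-∁ : ∀ {k k′ m} → k + k′ ≡ suc q → m ≤ planeSize q → InSp Π k′ (planeSize q ∸ m) → InSp Π k m
  InSp-∁ {m = m} k+k′≡1+q m≤N (S , ∣S∣≡N∸m , S-avoids) =
    ∁ S
    , trans (∣∁p∣≡n∸∣p∣ S) (trans (cong (planeSize q ∸_) ∣S∣≡N∸m) (m∸[m∸n]≡n m≤N))
    , ∁-avoiding {S = S} k+k′≡1+q S-avoids

  InSp-lowerRange : ∀ K → 2 ≤ K → K < q → ∀ n → n ≤ K * q + 1 → (suc K ≡ q → n ≢ K * q) →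
                    InSp Π (suc K) n
  InSp-lowerRange K _ K<q zero _ _ =
    Pencil.Partition⇒InSp origin {e = 0} z≤n refl (s≤s z≤n) (s≤s z≤n) z≤n ([] {r = 0})
  InSp-lowerRange K 2≤K@(s≤s (s≤s {n = r} _)) K<q (suc m) n≤Kq+1 exc =
    Pencil.Partition⇒InSp origin {e = 1} ≤-refl refl (s≤s (s≤s z≤n)) ≤-refl
      (≤-trans (n≤1+n K) (m≤n⇒m≤1+n K<q))
      (partition 2≤K K<q r m (≤-pred (subst (suc m ≤_) (+-comm (K * q) 1) n≤Kq+1)) exc)

  InSp-upperRange : ∀ k K′ → k + K′ ≡ q → 1 ≤ k → 2 ≤ K′ → ∀ m → (k + 1) * q ≤ m → m ≤ planeSize q →
                    (k ≡ 1 → m ≢ 2 * q + 1) → InSp Π k m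
  InSp-upperRange k K′ k+K′≡q 1≤k 2≤K′ m lo hi exc =
    InSp-∁ (trans (+-suc k K′) (cong suc k+K′≡q)) hi
      (InSp-lowerRange K′ 2≤K′ K′<q (planeSize q ∸ m) (m+n≡o∧m≤p⇒o∸p≤n (sym N≡) lo) exc′)
    where
    open ≡-Reasoning

    N≡ : planeSize q ≡ (k + 1) * q + (K′ * q + 1)
    N≡ = planeSize-split k K′ k+K′≡q

    K′<q : K′ < q
    K′<q = subst (K′ <_) k+K′≡q (m<n+m K′ 1≤k)

    exc′ : suc K′ ≡ q → planeSize q ∸ m ≢ K′ * q
    exc′ 1+K′≡q N∸m≡K′q = exc k≡1 (begin
      m                                     ≡⟨ m∸[m∸n]≡n hi ⟨
      planeSize q ∸ (planeSize q ∸ m)       ≡⟨ cong (planeSize q ∸_) N∸m≡K′q ⟩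
      planeSize q ∸ K′ * q                  ≡⟨ cong (_∸ K′ * q) N≡ ⟩
      (k + 1) * q + (K′ * q + 1) ∸ K′ * q   ≡⟨ m+[n+1]∸n≡m+1 ((k + 1) * q) (K′ * q) ⟩
      (k + 1) * q + 1                       ≡⟨ cong (λ k → (k + 1) * q + 1) k≡1 ⟩
      2 * q + 1                             ∎)
      where
      k≡1 : k ≡ 1
      k≡1 = +-cancelʳ-≡ K′ k 1 (trans k+K′≡q (sym 1+K′≡q))

  1-avoiding⇒2+q≤∣S∣ : ∀ {S P} → KAvoiding Π 1 S → P ∈ S → 2 + q ≤ ∣ S ∣
  1-avoiding⇒2+q≤∣S∣ {S} {P} S-avoids P∈S = begin-strict
    suc q               ≡⟨ pointDeg P ⟨
    ∣ linesThrough P ∣  ≤⟨ injective⇒∣p∣≤∣q∣ (linesThrough P) second second∈S-P second-injective ⟩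
    ∣ S - P ∣           <⟨ x∈p⇒∣p-x∣<∣p∣ P∈S ⟩
    ∣ S ∣               ∎
    where
    open ≤-Reasoning

    second-point : ∀ {l} → l ∈ linesThrough P → ∃ λ x → x ∈ S ∩ pointsOn l × x ∉ ⁅ P ⁆
    second-point {l} l∈ = ∣p∣<∣q∣⇒∃x∈q∖p ⁅ P ⁆ (S ∩ pointsOn l)
      (subst (_< ∣ S ∩ pointsOn l ∣) (sym (∣⁅x⁆∣≡1 P))
      (≤∧≢⇒< (x∈p⇒1≤∣p∣ (x∈p∩q⁺ (P∈S , ∈linesThrough⇒∈pointsOn l∈))) (≢-sym (S-avoids l))))

    second : ∀ {l} → l ∈ linesThrough P → Point
    second = proj₁ ∘ second-point

    second∈S∩l : ∀ {l} (l∈ : l ∈ linesThrough P) → second l∈ ∈ S ∩ pointsOn l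
    second∈S∩l = proj₁ ∘ proj₂ ∘ second-point

    second≢P : ∀ {l} (l∈ : l ∈ linesThrough P) → second l∈ ≢ P
    second≢P = x∉⁅y⁆⇒x≢y ∘ proj₂ ∘ proj₂ ∘ second-point

    second∈S-P : ∀ {l} (l∈ : l ∈ linesThrough P) → second l∈ ∈ S - P
    second∈S-P l∈ = x∈p∧x≢y⇒x∈p-y (proj₁ (x∈p∩q⁻ S _ (second∈S∩l l∈))) (second≢P l∈)

    second-injective : ∀ {l m} (l∈ : l ∈ linesThrough P) (m∈ : m ∈ linesThrough P) →
                       second l∈ ≡ second m∈ → l ≡ m
    second-injective {l} {m} l∈ m∈ same = join-unique (second≢P l∈)
      (proj₂ (x∈p∩q⁻ S _ (second∈S∩l l∈))) (∈linesThrough⇒∈pointsOn l∈)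
      (subst (_∈ pointsOn m) (sym same) (proj₂ (x∈p∩q⁻ S _ (second∈S∩l m∈)))) (∈linesThrough⇒∈pointsOn m∈)

  ¬InSp-1-≤q+1 : ∀ m → 1 ≤ m → m ≤ q + 1 → ¬ InSp Π 1 m
  ¬InSp-1-≤q+1 m 1≤m m≤q+1 (S , ∣S∣≡m , S-avoids) =
    let (P , P∈S) = 1≤∣p∣⇒Nonempty {p = S} (subst (1 ≤_) (sym ∣S∣≡m) 1≤m)
    in <⇒≱ ∣S∣<2+q (1-avoiding⇒2+q≤∣S∣ {S = S} S-avoids P∈S)
    where
    open ≤-Reasoning
    ∣S∣<2+q : ∣ S ∣ < 2 + q
    ∣S∣<2+q = begin-strict
      ∣ S ∣   ≡⟨ ∣S∣≡m ⟩
      m       ≤⟨ m≤q+1 ⟩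
      q + 1   ≡⟨ +-comm q 1 ⟩
      suc q   <⟨ n<1+n (suc q) ⟩
      2 + q   ∎

  ¬InSp-2-2 : ¬ InSp Π 2 2
  ¬InSp-2-2 (S , ∣S∣≡2 , S-avoids) =
    let (P , P∈S) = 1≤∣p∣⇒Nonempty (subst (1 ≤_) (sym ∣S∣≡2) (s≤s z≤n))
        (Q , Q∈S , Q∉⁅P⁆) = ∣p∣<∣q∣⇒∃x∈q∖p ⁅ P ⁆ S (subst₂ _<_ (sym (∣⁅x⁆∣≡1 P)) (sym ∣S∣≡2) ≤-refl)
        P≢Q = ≢-sym (x∉⁅y⁆⇒x≢y Q∉⁅P⁆)
        (l , (P∈l , Q∈l) , _) = joinLine P Q P≢Q
    in S-avoids l (≤-antisym
      (subst (∣ S ∩ pointsOn l ∣ ≤_) ∣S∣≡2 (∣p∩q∣≤∣p∣ S (pointsOn l)))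
      (x∈p∧y∈p∧x≢y⇒2≤∣p∣ (x∈p∩q⁺ (P∈S , ∈-tabulate⁺ P∈l)) (x∈p∩q⁺ (Q∈S , ∈-tabulate⁺ Q∈l)) P≢Q))

  InSp-k≥3 : ∀ k → 3 ≤ k → 2 * k ≤ q + 1 → ∀ m →
             (m ≤ (k ∸ 1) * q + 1 ⊎ ((k + 1) * q ≤ m × m ≤ planeSize q)) → InSp Π k m
  InSp-k≥3 k@(suc K) (s≤s 2≤K) 2k≤q+1 m (inj₁ m≤Kq+1) =
    InSp-lowerRange K 2≤K (<-trans (n<1+n K) k<q) m m≤Kq+1 (λ k≡q _ → <⇒≢ k<q k≡q)
    where
    k<q : k < q
    k<q = <-≤-trans (m<m+n k (s≤s z≤n)) (k+2≤q (s≤s 2≤K) 2k≤q+1)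
  InSp-k≥3 k 3≤k 2k≤q+1 m (inj₂ (lo , hi)) =
    let (o , k+2+o≡q) = m≤n⇒∃[o]m+o≡n (k+2≤q 3≤k 2k≤q+1)
    in InSp-upperRange k (2 + o) (trans (sym (+-assoc k 2 o)) k+2+o≡q)
         (≤-trans (s≤s z≤n) 3≤k) (s≤s (s≤s z≤n))
         m lo hi (λ k≡1 _ → >⇒≢ (≤-trans (s≤s (s≤s z≤n)) 3≤k) k≡1)

  InSp-1 : 4 ≤ q → ∀ m → (m ≡ 2 * q ⊎ (2 * q + 2 ≤ m × m ≤ planeSize q)) → InSp Π 1 m
  InSp-1 4≤q m range =
    InSp-upperRange 1 (q ∸ 1) (m+[n∸m]≡n 1≤q) ≤-refl (≤-trans (s≤s (s≤s z≤n)) (∸-monoˡ-≤ 1 4≤q)) m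
      (2q≤m range) (m≤N range) (λ _ → m≢2q+1 range)
    where
    Range = m ≡ 2 * q ⊎ (2 * q + 2 ≤ m × m ≤ planeSize q)
    1≤q : 1 ≤ q
    1≤q = ≤-trans (s≤s z≤n) 4≤q
    2q≤m : Range → 2 * q ≤ m
    2q≤m (inj₁ m≡2q) = ≤-reflexive (sym m≡2q)
    2q≤m (inj₂ (2q+2≤m , _)) = ≤-trans (m≤m+n (2 * q) 2) 2q+2≤m
    m≤N : Range → m ≤ planeSize q
    m≤N (inj₁ m≡2q) =
      subst₂ _≤_ (sym m≡2q) (sym (planeSize-split 1 (q ∸ 1) (m+[n∸m]≡n 1≤q))) (m≤m+n (2 * q) _)
    m≤N (inj₂ (_ , m≤N)) = m≤N
    m≢2q+1 : Range → m ≢ 2 * q + 1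
    m≢2q+1 (inj₁ m≡2q) = subst (_≢ 2 * q + 1) (sym m≡2q) (<⇒≢ (m<m+n (2 * q) (s≤s z≤n)))
    m≢2q+1 (inj₂ (2q+2≤m , _)) m≡2q+1 =
      <⇒≱ (+-monoʳ-< (2 * q) (n<1+n 1)) (subst (2 * q + 2 ≤_) m≡2q+1 2q+2≤m)

  InSp-2 : 4 ≤ q → ∀ m → ((m ≤ q + 1 × m ≢ 2) ⊎ (3 * q ≤ m × m ≤ planeSize q)) → InSp Π 2 m
  InSp-2 4≤q m (inj₁ (m≤q+1 , m≢2)) with m ≤? q
  ... | yes m≤q =
    Pencil.Partition⇒InSp origin {e = 0} z≤n refl (s≤s z≤n) ≤-refl (s≤s z≤n) (singleton m≤q m≢2)
  ... | no m≰q = subst (InSp Π 2) 1+q≡m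
    (Pencil.Partition⇒InSp origin {e = 1} ≤-refl refl ≤-refl ≤-refl (s≤s z≤n) (singleton ≤-refl q≢1))
    where
    q≢1 : q ≢ 1
    q≢1 = >⇒≢ (≤-trans (s≤s (s≤s z≤n)) 4≤q)
    1+q≡m : 1 + q ≡ m
    1+q≡m = ≤-antisym (≰⇒> m≰q) (subst (m ≤_) (+-comm q 1) m≤q+1)
  InSp-2 4≤q m (inj₂ (3q≤m , m≤N)) =
    InSp-upperRange 2 (q ∸ 2) (m+[n∸m]≡n (≤-trans (s≤s (s≤s z≤n)) 4≤q)) (s≤s z≤n) (∸-monoˡ-≤ 2 4≤q) m
      3q≤m m≤N (λ ())

mainTheorem5 : (q : ℕ) → 4 ≤ q → (Π : ProjectivePlane q) →
    (k : ℕ) → 1 ≤ k → 2 * k ≤ q + 1 →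
    (3 ≤ k → ∀ m →
        (m ≤ (k ∸ 1) * q + 1 ⊎ ((k + 1) * q ≤ m × m ≤ q * q + q + 1)) →
        InSp Π k m)
    × (k ≡ 1 →
        (∀ m → (m ≡ 2 * q ⊎ (2 * q + 2 ≤ m × m ≤ q * q + q + 1)) → InSp Π 1 m)
        × (∀ m → 1 ≤ m → m ≤ q + 1 → ¬ InSp Π 1 m))
    × (k ≡ 2 →
        (∀ m → ((m ≤ q + 1 × m ≢ 2) ⊎ (3 * q ≤ m × m ≤ q * q + q + 1)) → InSp Π 2 m)
        × ¬ InSp Π 2 2)
mainTheorem5 q 4≤q Π k _ 2k≤q+1 =
    (λ 3≤k → InSp-k≥3 Π k 3≤k 2k≤q+1)
  , (λ { refl → InSp-1 Π 4≤q , ¬InSp-1-≤q+1 Π })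
  , (λ { refl → InSp-2 Π 4≤q , ¬InSp-2-2 Π })
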